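{- The proof system $\mathbf{LFD}$ is sound and complete for dependence models: an LFD formula is provable in $\mathbf{LFD}$ iff it is valid.
   Context: Fix a set $V$ of variables and a relational vocabulary. A dependence model is $\mathbf{M}=(O,I,A)$ with $O$ a set of objects, $I(P)\subseteq O^{n}$ for each $n$-ary predicate $P$, and $A\subseteq O^V$ a set of admissible assignments; $s=_X t$ means $s(x)=t(x)$ for all $x\in X$. LFD formulas: $\varphi::=P\mathbf{x}\mid\neg\varphi\mid\varphi\wedge\varphi\mid\mathbb{D}_X\varphi\mid D_X y$ ($X$ finite subset of $V$, $y\in V$). Semantics at $s\in A$: $P\mathbf{x}$ iff $s(\mathbf{x})\in I(P)$; Booleans as usual; $\mathbb{D}_X\varphi$ iff $t\models\varphi$ for all $t\in A$ with $s=_X t$; $D_X y$ iff for all $t\in A$, $s=_X t$ implies $s(y)=t(y)$. Valid = true at every admissible assignment of every dependence model. Free variables: $\mathrm{Free}(Px_1\dots x_n)=\{x_1,\dots,x_n\}$, $\mathrm{Free}(\neg\varphi)=\mathrm{Free}(\varphi)$, $\mathrm{Free}(\varphi\wedge\psi)=\mathrm{Free}(\varphi)\cup\mathrm{Free}(\psi)$, $\mathrm{Free}(\mathbb{D}_X\varphi)=\mathrm{Free}(D_Xy)=X$. For finite $Y$, $D_XY:=\bigwedge_{y\in Y}D_Xy$. The Hilbert system $\mathbf{LFD}$ consists of: (I) all axioms and rules of classical propositional logic; (II) $\mathbb{D}$-Necessitation: from $\varphi$ infer $\mathbb{D}_X\varphi$; $\mathbb{D}$-Distribution: $\mathbb{D}_X(\varphi\to\psi)\to(\mathbb{D}_X\varphi\to\mathbb{D}_X\psi)$;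 $\mathbb{D}$-Introduction: $\varphi\to\mathbb{D}_X\varphi$ provided $\mathrm{Free}(\varphi)\subseteq X$; $\mathbb{D}$-Elimination: $\mathbb{D}_X\varphi\to\varphi$; (III) Projection: $D_Xx$ provided $x\in X$; Transitivity: $(D_XY\wedge D_YZ)\to D_XZ$; (IV) Transfer: $(D_XY\wedge\mathbb{D}_Y\varphi)\to\mathbb{D}_X\varphi$. Here $X,Y,Z$ range over finite subsets of $V$. -}

module Defs where

open import Data.Nat using (ℕ)
open import Data.Bool using (Bool; true; false; not) renaming (_∧_ to _&&_)
open import Data.List using (List; []; _∷_; map)
open import Data.List.Membership.Propositional using (_∈_)
open import Data.List.Relation.Binary.Subset.Propositional using (_⊆_)
open import Data.Vec using (Vec; toList) renaming (map to vmap)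
open import Data.Product using (_×_)
open import Relation.Nullary using (¬_)
open import Relation.Binary.PropositionalEquality using (_≡_)

-- Finite subsets X of V are represented by lists (only membership matters).
module LFD (V : Set) (Pred : Set) (ar : Pred → ℕ) where

  infixr 6 _∧ᶠ_

  data Formula : Set where
    atom  : (P : Pred) → Vec V (ar P) → Formula
    ¬ᶠ_   : Formula → Formula
    _∧ᶠ_  : Formula → Formula → Formula
    𝔻     : List V → Formula → Formula
    D     : List V → V → Formula

  _⇒_ : Formula → Formula → Formula
  φ ⇒ ψ = ¬ᶠ (φ ∧ᶠ ¬ᶠ ψ)

  conj : List Formula → Formula → Formula
  conj []       χ = χ
  conj (ψ ∷ ψs) χ = ψ ∧ᶠ conj ψs χ

  -- D_X {z} ∪ Z  =  D_X z ∧ ⋀_{z' ∈ Z} D_X z'   (nonempty conjunction)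
  DAll₁ : List V → V → List V → Formula
  DAll₁ X z Z = conj (map (D X) Z) (D X z)

  Free : Formula → List V
  Free (atom P xs) = toList xs
  Free (¬ᶠ φ)      = Free φ
  Free (φ ∧ᶠ ψ)    = Data.List._++_ (Free φ) (Free ψ)
  Free (𝔻 X φ)     = X
  Free (D X y)     = X

  evalB : (Formula → Bool) → Formula → Bool
  evalB v (atom P xs) = v (atom P xs)
  evalB v (¬ᶠ φ)      = not (evalB v φ)
  evalB v (φ ∧ᶠ ψ)    = evalB v φ && evalB v ψ
  evalB v (𝔻 X φ)     = v (𝔻 X φ)
  evalB v (D X y)     = v (D X y)

  -- substitution instances of propositional tautologies
  Tautology : Formula → Set
  Tautology φ = (v : Formula → Bool) → evalB v φ ≡ true

  data ⊢_ : Formula → Set where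
    taut       : ∀ {φ} → Tautology φ → ⊢ φ
    mp         : ∀ {φ ψ} → ⊢ (φ ⇒ ψ) → ⊢ φ → ⊢ ψ
    𝔻-nec      : ∀ {φ} X → ⊢ φ → ⊢ 𝔻 X φ
    𝔻-dist     : ∀ X φ ψ → ⊢ (𝔻 X (φ ⇒ ψ) ⇒ (𝔻 X φ ⇒ 𝔻 X ψ))
    𝔻-intro    : ∀ X φ → Free φ ⊆ X → ⊢ (φ ⇒ 𝔻 X φ)
    𝔻-elim     : ∀ X φ → ⊢ (𝔻 X φ ⇒ φ)
    projection : ∀ X x → x ∈ X → ⊢ D X x
    -- (D_X Y ∧ D_Y Z) → D_X Z, for nonempty Z = z ∷ Z (for Z = ∅ the
    -- conclusion is the empty conjunction ⊤ and the instance is trivial)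
    transitivity : ∀ X Y z Z →
      ⊢ (conj (map (D X) Y) (DAll₁ Y z Z) ⇒ DAll₁ X z Z)
    transfer   : ∀ X Y φ → ⊢ (conj (map (D X) Y) (𝔻 Y φ) ⇒ 𝔻 X φ)

  record Model : Set₁ where
    field
      O : Set
      I : (P : Pred) → Vec O (ar P) → Set
      A : (V → O) → Set

  _=[_]_ : {O : Set} → (V → O) → List V → (V → O) → Set
  s =[ X ] t = ∀ x → x ∈ X → s x ≡ t x

  _,_⊨_ : (M : Model) → (V → Model.O M) → Formula → Set
  M , s ⊨ atom P xs = Model.I M P (vmap s xs)
  M , s ⊨ (¬ᶠ φ)    = ¬ (M , s ⊨ φ)
  M , s ⊨ (φ ∧ᶠ ψ)  = (M , s ⊨ φ) × (M , s ⊨ ψ)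
  M , s ⊨ 𝔻 X φ     = ∀ t → Model.A M t → s =[ X ] t → M , t ⊨ φ
  M , s ⊨ D X y     = ∀ t → Model.A M t → s =[ X ] t → s y ≡ t y

  Valid : Formula → Set₁
  Valid φ = (M : Model) (s : V → Model.O M) → Model.A M s → M , s ⊨ φ

-- Soundness is checked axiom by axiom; a propositional tautology is valid because, classically,
-- the truth of formulas at a fixed assignment is a Boolean valuation.
--
-- Completeness follows the paper: a finite canonical model, then an unravelling.  Let Φ be the
-- subformulas of φ₀ together with all D_X y for the variable sets X and variables y of φ₀.
-- Worlds are hypothesis lists maximal consistent relative to Φ, and two worlds agree on X when
-- they prove the same formulas of Φ whose free variables they prove X-determined.  Transfer and
-- 𝔻-Introduction push the X-determined part of a world under 𝔻_X, so every ¬𝔻_X ψ has an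
-- X-agreeing witness world proving ¬ψ.  To make dependence atoms true, assignments are paths of
-- such agreeing steps, and the value of x at a path is the last step at which D_X x was not
-- proved: x changes value exactly where the worlds allow it.  Two path assignments that agree on
-- X end in X-agreeing worlds, and the truth lemma follows by induction on subformulas.

module Submission where

open import Defs
open import Data.Nat using (ℕ; zero; suc; _≤_; s≤s; _≤?_)
open import Data.Nat.Properties using (≤-refl; ≤-trans; m≤n⇒m≤1+n; 1+n≰n; ≰⇒≥)
open import Data.Unit using (⊤; tt)
open import Data.Bool using (Bool; true; false; not) renaming (_∧_ to _&&_; _≟_ to _≟ᵇ_)
open import Data.Product using (Σ; _×_; _,_; proj₁; proj₂)
open import Data.Sum using (_⊎_; inj₁; inj₂)
import Data.Sum as Sum
open import Data.List using (List; []; _∷_; map; _++_; concatMap; cartesianProductWith; filter)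
open import Data.List.Membership.Propositional using (_∈_; find; lose)
open import Data.List.Relation.Binary.Subset.Propositional using (_⊆_)
open import Data.List.Membership.Propositional.Properties
  using (∈-++⁺ˡ; ∈-++⁺ʳ; ∈-++⁻; ∈-map⁺; ∈-map⁻; ∈-filter⁺; ∈-filter⁻; ∈-concatMap⁺; ∈-concatMap⁻;
         ∈-cartesianProductWith⁺; ∈-cartesianProductWith⁻)
open import Data.List.Relation.Unary.Any using (here; there)
open import Data.List.Relation.Unary.All using (All; []; _∷_)
import Data.List.Relation.Unary.All as All
import Data.List.Relation.Unary.All.Properties as All
open import Data.Vec.Properties using (∷-injectiveˡ; ∷-injectiveʳ)
open import Data.Vec using (Vec; toList) renaming (map to vmap; [] to []ᵛ; _∷_ to _∷ᵛ_)
open import Data.Empty using (⊥; ⊥-elim)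
open import Function using (_∘_; id)
open import Function.Bundles using (_⇔_; mk⇔; Equivalence)
open import Function.Construct.Identity using (⇔-id)
open import Function.Construct.Symmetry using (⇔-sym)
open import Function.Construct.Composition using (_⇔-∘_)
open import Relation.Nullary using (¬_; Dec; yes; no; does)
open import Relation.Nullary.Decidable using (decidable-stable)
open import Relation.Binary.PropositionalEquality using (_≡_; refl; sym; trans; cong; cong₂; subst)
open import Level using (0ℓ)
open import Axiom.ExcludedMiddle using (ExcludedMiddle)
open import Axiom.DoubleNegationElimination using (em⇒dne)

open Equivalence using (to; from)

module _ (V Pred : Set) (ar : Pred → ℕ) where
  open LFD V Pred ar

  infix 4 _⊨ᵇ_
  _⊨ᵇ_ : (Formula → Bool) → Formula → Set
  v ⊨ᵇ ψ = evalB v ψ ≡ true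

  ⊨ᵇ? : ∀ v ψ → Dec (v ⊨ᵇ ψ)
  ⊨ᵇ? v ψ = evalB v ψ ≟ᵇ true

  ¬ᵇ⁺ : ∀ v ψ → ¬ v ⊨ᵇ ψ → v ⊨ᵇ ¬ᶠ ψ
  ¬ᵇ⁺ v ψ n with evalB v ψ
  ... | false = refl
  ... | true  = ⊥-elim (n refl)

  ¬ᵇ⁻ : ∀ v ψ → v ⊨ᵇ ¬ᶠ ψ → ¬ v ⊨ᵇ ψ
  ¬ᵇ⁻ v ψ t u with () ← trans (sym (cong not u)) t

  ∧ᵇ⁺ : ∀ v φ ψ → v ⊨ᵇ φ → v ⊨ᵇ ψ → v ⊨ᵇ φ ∧ᶠ ψ
  ∧ᵇ⁺ v φ ψ = cong₂ _&&_

  ∧ᵇ⁻ : ∀ v φ ψ → v ⊨ᵇ φ ∧ᶠ ψ → v ⊨ᵇ φ × v ⊨ᵇ ψ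
  ∧ᵇ⁻ v φ ψ t with evalB v φ | evalB v ψ | t
  ... | true | true | _ = refl , refl

  ⇒ᵇ⁺ : ∀ v φ ψ → (v ⊨ᵇ φ → v ⊨ᵇ ψ) → v ⊨ᵇ φ ⇒ ψ
  ⇒ᵇ⁺ v φ ψ f = ¬ᵇ⁺ v (φ ∧ᶠ ¬ᶠ ψ) λ t →
    let tφ , t¬ψ = ∧ᵇ⁻ v φ (¬ᶠ ψ) t in ¬ᵇ⁻ v ψ t¬ψ (f tφ)

  ⇒ᵇ⁻ : ∀ v φ ψ → v ⊨ᵇ φ ⇒ ψ → v ⊨ᵇ φ → v ⊨ᵇ ψ
  ⇒ᵇ⁻ v φ ψ t tφ = decidable-stable (⊨ᵇ? v ψ) λ ¬tψ →
    ¬ᵇ⁻ v (φ ∧ᶠ ¬ᶠ ψ) t (∧ᵇ⁺ v φ (¬ᶠ ψ) tφ (¬ᵇ⁺ v ψ ¬tψ))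

  infixr 5 _⇒*_
  _⇒*_ : List Formula → Formula → Formula
  []       ⇒* χ = χ
  (ψ ∷ ψs) ⇒* χ = ψ ⇒ (ψs ⇒* χ)

  ⇒*ᵇ⁺ : ∀ v ψs χ → (All (v ⊨ᵇ_) ψs → v ⊨ᵇ χ) → v ⊨ᵇ ψs ⇒* χ
  ⇒*ᵇ⁺ v []       χ f = f []
  ⇒*ᵇ⁺ v (ψ ∷ ψs) χ f = ⇒ᵇ⁺ v ψ (ψs ⇒* χ) λ t → ⇒*ᵇ⁺ v ψs χ (λ ts → f (t ∷ ts))

  ⇒*ᵇ⁻ : ∀ v ψs χ → v ⊨ᵇ ψs ⇒* χ → All (v ⊨ᵇ_) ψs → v ⊨ᵇ χ
  ⇒*ᵇ⁻ v []       χ t []        = t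
  ⇒*ᵇ⁻ v (ψ ∷ ψs) χ t (tψ ∷ ts) = ⇒*ᵇ⁻ v ψs χ (⇒ᵇ⁻ v ψ (ψs ⇒* χ) t tψ) ts

  ⊢-⇒*-elim : ∀ ψs {χ} → ⊢ (ψs ⇒* χ) → All (⊢_) ψs → ⊢ χ
  ⊢-⇒*-elim []       d []        = d
  ⊢-⇒*-elim (ψ ∷ ψs) d (dψ ∷ ds) = ⊢-⇒*-elim ψs (mp d dψ) ds

  ⊢-taut : ∀ ψs χ → All (⊢_) ψs → (∀ v → All (v ⊨ᵇ_) ψs → v ⊨ᵇ χ) → ⊢ χ
  ⊢-taut ψs χ ds f = ⊢-⇒*-elim ψs (taut λ v → ⇒*ᵇ⁺ v ψs χ (f v)) ds

  infix 4 _⊩_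
  -- A record rather than a synonym, so that Γ and ψ are inferable from the type.
  record _⊩_ (Γ : List Formula) (ψ : Formula) : Set where
    constructor ⊩-intro
    field deduction : ⊢ (Γ ⇒* ψ)
  open _⊩_

  ⊩-taut : ∀ Γ ψs χ → All (Γ ⊩_) ψs →
           (∀ v → All (v ⊨ᵇ_) Γ → All (v ⊨ᵇ_) ψs → v ⊨ᵇ χ) → Γ ⊩ χ
  ⊩-taut Γ ψs χ ds f = ⊩-intro (⊢-taut (map (Γ ⇒*_) ψs) (Γ ⇒* χ) (All.map⁺ (All.map deduction ds))
    λ v ts → ⇒*ᵇ⁺ v Γ χ λ tΓ → f v tΓ (All.map (λ {ψ} t → ⇒*ᵇ⁻ v Γ ψ t tΓ) (All.map⁻ ts)))

  ⊩-∈ : ∀ {Γ ψ} → ψ ∈ Γ → Γ ⊩ ψ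
  ⊩-∈ {Γ} {ψ} ψ∈Γ = ⊩-taut Γ [] ψ [] λ v tΓ _ → All.lookup tΓ ψ∈Γ

  ⊢⇒⊩ : ∀ {Γ ψ} → ⊢ ψ → Γ ⊩ ψ
  ⊢⇒⊩ {Γ} {ψ} d = ⊩-intro (⊢-taut (ψ ∷ []) (Γ ⇒* ψ) (d ∷ []) λ { v (t ∷ []) → ⇒*ᵇ⁺ v Γ ψ λ _ → t })

  ⊩-mp : ∀ {Γ φ ψ} → Γ ⊩ φ ⇒ ψ → Γ ⊩ φ → Γ ⊩ ψ
  ⊩-mp {Γ} {φ} {ψ} d e = ⊩-taut Γ _ ψ (d ∷ e ∷ []) λ { v _ (t ∷ tφ ∷ []) → ⇒ᵇ⁻ v φ ψ t tφ }

  ⊩-∧⁺ : ∀ {Γ φ ψ} → Γ ⊩ φ → Γ ⊩ ψ → Γ ⊩ φ ∧ᶠ ψ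
  ⊩-∧⁺ {Γ} {φ} {ψ} d e = ⊩-taut Γ _ _ (d ∷ e ∷ []) λ { v _ (tφ ∷ tψ ∷ []) → ∧ᵇ⁺ v φ ψ tφ tψ }

  ⊩-∧⁻ˡ : ∀ {Γ φ ψ} → Γ ⊩ φ ∧ᶠ ψ → Γ ⊩ φ
  ⊩-∧⁻ˡ {Γ} {φ} {ψ} d = ⊩-taut Γ _ _ (d ∷ []) λ { v _ (t ∷ []) → proj₁ (∧ᵇ⁻ v φ ψ t) }

  ⊩-∧⁻ʳ : ∀ {Γ φ ψ} → Γ ⊩ φ ∧ᶠ ψ → Γ ⊩ ψ
  ⊩-∧⁻ʳ {Γ} {φ} {ψ} d = ⊩-taut Γ _ _ (d ∷ []) λ { v _ (t ∷ []) → proj₂ (∧ᵇ⁻ v φ ψ t) }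

  ⊩-cut : ∀ {Γ} Δ {ψ} → (∀ {δ} → δ ∈ Δ → Γ ⊩ δ) → ⊢ (Δ ⇒* ψ) → Γ ⊩ ψ
  ⊩-cut {Γ} Δ {ψ} hs d = ⊩-taut Γ ((Δ ⇒* ψ) ∷ Δ) ψ (⊢⇒⊩ d ∷ All.tabulate hs)
    λ { v _ (t ∷ tΔ) → ⇒*ᵇ⁻ v Δ ψ t tΔ }

  ⊩-cases : ∀ Γ ψ χ → (ψ ∷ Γ) ⊩ χ → (¬ᶠ ψ ∷ Γ) ⊩ χ → Γ ⊩ χ
  ⊩-cases Γ ψ χ (⊩-intro d) (⊩-intro e) = ⊩-intro (⊢-taut (_ ∷ _ ∷ []) (Γ ⇒* χ) (d ∷ e ∷ [])
    λ { v (t ∷ u ∷ []) → ⇒*ᵇ⁺ v Γ χ λ tΓ → case′ v t u tΓ (⊨ᵇ? v ψ) })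
    where
    case′ : ∀ v → v ⊨ᵇ (ψ ∷ Γ) ⇒* χ → v ⊨ᵇ (¬ᶠ ψ ∷ Γ) ⇒* χ → All (v ⊨ᵇ_) Γ → Dec (v ⊨ᵇ ψ) → v ⊨ᵇ χ
    case′ v t u tΓ (yes tψ) = ⇒*ᵇ⁻ v (ψ ∷ Γ) χ t (tψ ∷ tΓ)
    case′ v t u tΓ (no ¬tψ) = ⇒*ᵇ⁻ v (¬ᶠ ψ ∷ Γ) χ u (¬ᵇ⁺ v ψ ¬tψ ∷ tΓ)

  infix 4 _⊩D[_]_
  _⊩D[_]_ : List Formula → List V → List V → Set
  Γ ⊩D[ X ] Y = ∀ {y} → y ∈ Y → Γ ⊩ D X y

  ⊩D-⊆ : ∀ {Γ X Y} → Y ⊆ X → Γ ⊩D[ X ] Y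
  ⊩D-⊆ Y⊆X y∈ = ⊢⇒⊩ (projection _ _ (Y⊆X y∈))

  ⊩-conjD : ∀ {Γ} X Y χ → Γ ⊩D[ X ] Y → Γ ⊩ χ → Γ ⊩ conj (map (D X) Y) χ
  ⊩-conjD X []      χ ds d = d
  ⊩-conjD X (y ∷ Y) χ ds d = ⊩-∧⁺ (ds (here refl)) (⊩-conjD X Y χ (ds ∘ there) d)

  ⊩-D-trans : ∀ {Γ X Y z} → Γ ⊩D[ X ] Y → Γ ⊩ D Y z → Γ ⊩ D X z
  ⊩-D-trans {X = X} {Y} {z} XY d = ⊩-mp (⊢⇒⊩ (transitivity X Y z [])) (⊩-conjD X Y _ XY d)

  ⊩D-trans : ∀ {Γ X Y Z} → Γ ⊩D[ X ] Y → Γ ⊩D[ Y ] Z → Γ ⊩D[ X ] Z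
  ⊩D-trans XY YZ z∈ = ⊩-D-trans XY (YZ z∈)

  ⊩-transfer : ∀ {Γ X Y ψ} → Γ ⊩D[ X ] Y → Γ ⊩ 𝔻 Y ψ → Γ ⊩ 𝔻 X ψ
  ⊩-transfer {X = X} {Y} {ψ} XY d = ⊩-mp (⊢⇒⊩ (transfer X Y ψ)) (⊩-conjD X Y _ XY d)

  ⊩-𝔻-determined : ∀ {Γ X ψ} → Γ ⊩D[ X ] Free ψ → Γ ⊩ ψ → Γ ⊩ 𝔻 X ψ
  ⊩-𝔻-determined {ψ = ψ} ds d = ⊩-transfer ds (⊩-mp (⊢⇒⊩ (𝔻-intro (Free ψ) ψ id)) d)

  𝔻-⇒* : ∀ X ψs χ → ⊢ (𝔻 X (ψs ⇒* χ) ⇒ (map (𝔻 X) ψs ⇒* 𝔻 X χ))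
  𝔻-⇒* X []       χ = ⊢-taut [] (𝔻 X χ ⇒ 𝔻 X χ) [] λ v _ → ⇒ᵇ⁺ v (𝔻 X χ) (𝔻 X χ) λ t → t
  𝔻-⇒* X (ψ ∷ ψs) χ = ⊢-taut (_ ∷ _ ∷ []) (□[ψ⇒χs] ⇒ (□ψ ⇒ □ψs⇒□χ))
    (𝔻-dist X ψ (ψs ⇒* χ) ∷ 𝔻-⇒* X ψs χ ∷ [])
    λ { v (dist ∷ ih ∷ []) → ⇒ᵇ⁺ v □[ψ⇒χs] (□ψ ⇒ □ψs⇒□χ) λ t → ⇒ᵇ⁺ v □ψ □ψs⇒□χ λ tψ →
          ⇒ᵇ⁻ v □χs □ψs⇒□χ ih (⇒ᵇ⁻ v □ψ □χs (⇒ᵇ⁻ v □[ψ⇒χs] (□ψ ⇒ □χs) dist t) tψ) }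
    where
    □[ψ⇒χs] = 𝔻 X (ψ ⇒ (ψs ⇒* χ))
    □ψ = 𝔻 X ψ
    □χs = 𝔻 X (ψs ⇒* χ)
    □ψs⇒□χ = map (𝔻 X) ψs ⇒* 𝔻 X χ

  RK : ∀ X ψs χ → ⊢ (ψs ⇒* χ) → ⊢ (map (𝔻 X) ψs ⇒* 𝔻 X χ)
  RK X ψs χ d = mp (𝔻-⇒* X ψs χ) (𝔻-nec X d)

  map-cong-on : {O : Set} {n : ℕ} {s t : V → O} (xs : Vec V n) → s =[ toList xs ] t → vmap s xs ≡ vmap t xs
  map-cong-on []ᵛ       eq = refl
  map-cong-on (x ∷ᵛ xs) eq = cong₂ _∷ᵛ_ (eq x (here refl)) (map-cong-on xs λ y y∈ → eq y (there y∈))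

  ⊨-coincidence : ∀ M φ {s t} → Model.A M s → Model.A M t → s =[ Free φ ] t → M , s ⊨ φ → M , t ⊨ φ
  ⊨-coincidence M (atom P xs) As At eq p = subst (Model.I M P) (map-cong-on xs eq) p
  ⊨-coincidence M (¬ᶠ φ) As At eq p q = p (⊨-coincidence M φ At As (λ x x∈ → sym (eq x x∈)) q)
  ⊨-coincidence M (φ ∧ᶠ ψ) As At eq (p , q) =
    ⊨-coincidence M φ As At (λ x x∈ → eq x (∈-++⁺ˡ x∈)) p ,
    ⊨-coincidence M ψ As At (λ x x∈ → eq x (∈-++⁺ʳ (Free φ) x∈)) q
  ⊨-coincidence M (𝔻 X φ) As At eq p u Au eq′ = p u Au λ x x∈ → trans (eq x x∈) (eq′ x x∈)
  ⊨-coincidence M (D X y) As At eq p u Au eq′ =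
    trans (sym (p _ At eq)) (p u Au λ x x∈ → trans (eq x x∈) (eq′ x x∈))

  ⊨-conjD⁻ : ∀ M s X Y χ → M , s ⊨ conj (map (D X) Y) χ → (∀ {y} → y ∈ Y → M , s ⊨ D X y) × M , s ⊨ χ
  ⊨-conjD⁻ M s X []      χ p       = (λ ()) , p
  ⊨-conjD⁻ M s X (y ∷ Y) χ (p , q) =
    (λ { (here refl) → p ; (there y∈) → proj₁ IH y∈ }) , proj₂ IH
    where IH = ⊨-conjD⁻ M s X Y χ q

  ⊨-conjD⁺ : ∀ M s X Y χ → (∀ {y} → y ∈ Y → M , s ⊨ D X y) → M , s ⊨ χ → M , s ⊨ conj (map (D X) Y) χ
  ⊨-conjD⁺ M s X []      χ ps p = p
  ⊨-conjD⁺ M s X (y ∷ Y) χ ps p = ps (here refl) , ⊨-conjD⁺ M s X Y χ (ps ∘ there) p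

  module Soundness (em : ExcludedMiddle 0ℓ) where

    ⇒-sem⁺ : {A B : Set} → (A → B) → ¬ (A × ¬ B)
    ⇒-sem⁺ f (a , ¬b) = ¬b (f a)

    ⇒-sem⁻ : {A B : Set} → ¬ (A × ¬ B) → A → B
    ⇒-sem⁻ f a = em⇒dne em λ ¬b → f (a , ¬b)

    module _ (M : Model) (s : V → Model.O M) where

      truthValuation : Formula → Bool
      truthValuation ψ = does (em {M , s ⊨ ψ})

      does-em : ∀ ψ → does (em {M , s ⊨ ψ}) ≡ true ⇔ M , s ⊨ ψ
      does-em ψ with em {M , s ⊨ ψ}
      ... | yes p = mk⇔ (λ _ → p) (λ _ → refl)
      ... | no ¬p = mk⇔ (λ ()) (λ p → ⊥-elim (¬p p))

      truthValuation-correct : ∀ ψ → truthValuation ⊨ᵇ ψ ⇔ M , s ⊨ ψ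
      truthValuation-correct (atom P xs) = does-em (atom P xs)
      truthValuation-correct (¬ᶠ ψ) = mk⇔
        (λ t p → ¬ᵇ⁻ truthValuation ψ t (from IH p))
        (λ ¬p → ¬ᵇ⁺ truthValuation ψ (λ t → ¬p (to IH t)))
        where IH = truthValuation-correct ψ
      truthValuation-correct (φ ∧ᶠ ψ) = mk⇔
        (λ t → let tφ , tψ = ∧ᵇ⁻ truthValuation φ ψ t in to IHφ tφ , to IHψ tψ)
        (λ (p , q) → ∧ᵇ⁺ truthValuation φ ψ (from IHφ p) (from IHψ q))
        where IHφ = truthValuation-correct φ
              IHψ = truthValuation-correct ψ
      truthValuation-correct (𝔻 X ψ) = does-em (𝔻 X ψ)
      truthValuation-correct (D X y) = does-em (D X y)

    soundness : ∀ {φ} → ⊢ φ → Valid φ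
    soundness {φ} (taut t) M s As = to (truthValuation-correct M s φ) (t (truthValuation M s))
    soundness (mp d e) M s As = ⇒-sem⁻ (soundness d M s As) (soundness e M s As)
    soundness (𝔻-nec X d) M s As t At _ = soundness d M t At
    soundness (𝔻-dist X φ ψ) M s As = ⇒-sem⁺ λ f → ⇒-sem⁺ λ p t At eq → ⇒-sem⁻ (f t At eq) (p t At eq)
    soundness (𝔻-intro X φ Free⊆X) M s As =
      ⇒-sem⁺ λ p t At eq → ⊨-coincidence M φ As At (λ x x∈ → eq x (Free⊆X x∈)) p
    soundness (𝔻-elim X φ) M s As = ⇒-sem⁺ λ p → p s As λ _ _ → refl
    soundness (projection X x x∈) M s As t At eq = eq x x∈
    soundness (transitivity X Y z Z) M s As = ⇒-sem⁺ λ p →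
      let XY , YZ = ⊨-conjD⁻ M s X Y _ p
          Yz , Yz′ = ⊨-conjD⁻ M s Y Z _ YZ
          lift : ∀ {w} → M , s ⊨ D Y w → M , s ⊨ D X w
          lift q t At eq = q t At λ y y∈ → XY y∈ t At eq
      in ⊨-conjD⁺ M s X Z _ (lift ∘ Yz) (lift Yz′)
    soundness (transfer X Y φ) M s As = ⇒-sem⁺ λ p t At eq →
      let XY , □φ = ⊨-conjD⁻ M s X Y _ p in □φ t At λ y y∈ → XY y∈ t At eq

  Sub : Formula → List Formula
  Sub (atom P xs) = atom P xs ∷ []
  Sub (¬ᶠ φ)      = ¬ᶠ φ ∷ Sub φ
  Sub (φ ∧ᶠ ψ)    = (φ ∧ᶠ ψ) ∷ (Sub φ ++ Sub ψ)
  Sub (𝔻 X φ)     = 𝔻 X φ ∷ Sub φ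
  Sub (D X y)     = D X y ∷ []

  Sub-refl : ∀ φ → φ ∈ Sub φ
  Sub-refl (atom P xs) = here refl
  Sub-refl (¬ᶠ φ)      = here refl
  Sub-refl (φ ∧ᶠ ψ)    = here refl
  Sub-refl (𝔻 X φ)     = here refl
  Sub-refl (D X y)     = here refl

  Sub-trans : ∀ φ {χ ψ} → χ ∈ Sub φ → ψ ∈ Sub χ → ψ ∈ Sub φ
  Sub-trans (atom P xs) (here refl) ψ∈ = ψ∈
  Sub-trans (¬ᶠ φ)      (here refl) ψ∈ = ψ∈
  Sub-trans (¬ᶠ φ)      (there χ∈)  ψ∈ = there (Sub-trans φ χ∈ ψ∈)
  Sub-trans (𝔻 X φ)     (here refl) ψ∈ = ψ∈
  Sub-trans (𝔻 X φ)     (there χ∈)  ψ∈ = there (Sub-trans φ χ∈ ψ∈)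
  Sub-trans (D X y)     (here refl) ψ∈ = ψ∈
  Sub-trans (φ ∧ᶠ ψ)    (here refl) ψ∈ = ψ∈
  Sub-trans (φ ∧ᶠ ψ)    (there χ∈)  ψ∈ with ∈-++⁻ (Sub φ) χ∈
  ... | inj₁ χ∈φ = there (∈-++⁺ˡ (Sub-trans φ χ∈φ ψ∈))
  ... | inj₂ χ∈ψ = there (∈-++⁺ʳ (Sub φ) (Sub-trans ψ χ∈ψ ψ∈))

  varsOf : Formula → List V
  varsOf (D X y) = y ∷ X
  varsOf φ       = Free φ

  Free⊆varsOf : ∀ φ → Free φ ⊆ varsOf φ
  Free⊆varsOf (atom P xs) = id
  Free⊆varsOf (¬ᶠ φ)      = id
  Free⊆varsOf (φ ∧ᶠ ψ)    = id
  Free⊆varsOf (𝔻 X φ)     = id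
  Free⊆varsOf (D X y)     = there

  varSetsOf : Formula → List (List V)
  varSetsOf (atom P xs) = toList xs ∷ []
  varSetsOf (¬ᶠ φ)      = []
  varSetsOf (φ ∧ᶠ ψ)    = []
  varSetsOf (𝔻 X φ)     = X ∷ []
  varSetsOf (D X y)     = X ∷ []

  varSetsOf⊆varsOf : ∀ φ {X} → X ∈ varSetsOf φ → X ⊆ varsOf φ
  varSetsOf⊆varsOf (atom P xs) (here refl) = id
  varSetsOf⊆varsOf (𝔻 Y φ)     (here refl) = id
  varSetsOf⊆varsOf (D Y y)     (here refl) = there

  module Closure (φ₀ : Formula) where

    S : List Formula
    S = Sub φ₀

    Vars : List V
    Vars = concatMap varsOf S

    VarSets : List (List V)
    VarSets = concatMap varSetsOf S

    Φ : List Formula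
    Φ = S ++ cartesianProductWith D VarSets Vars

    S⊆Φ : S ⊆ Φ
    S⊆Φ = ∈-++⁺ˡ

    D∈Φ : ∀ {X y} → X ∈ VarSets → y ∈ Vars → D X y ∈ Φ
    D∈Φ X∈ y∈ = ∈-++⁺ʳ S (∈-cartesianProductWith⁺ D X∈ y∈)

    VarSets⊆Vars : ∀ {X} → X ∈ VarSets → X ⊆ Vars
    VarSets⊆Vars X∈ x∈ with φ , φ∈ , X∈φ ← find (∈-concatMap⁻ varSetsOf {S} X∈) =
      ∈-concatMap⁺ varsOf (lose φ∈ (varSetsOf⊆varsOf φ X∈φ x∈))

    Free⊆Vars : ∀ {φ} → φ ∈ Φ → Free φ ⊆ Vars
    Free⊆Vars {φ} φ∈ x∈ with ∈-++⁻ S φ∈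
    ... | inj₁ φ∈S = ∈-concatMap⁺ varsOf (lose φ∈S (Free⊆varsOf φ x∈))
    ... | inj₂ φ∈D with X , y , X∈ , y∈ , refl ← ∈-cartesianProductWith⁻ D VarSets Vars φ∈D =
      VarSets⊆Vars X∈ x∈

    varSetsOf⊆VarSets : ∀ {φ X} → φ ∈ S → X ∈ varSetsOf φ → X ∈ VarSets
    varSetsOf⊆VarSets φ∈ X∈ = ∈-concatMap⁺ varSetsOf (lose φ∈ X∈)

    D∈S⇒∈Vars : ∀ {X y} → D X y ∈ S → y ∈ Vars
    D∈S⇒∈Vars D∈ = ∈-concatMap⁺ varsOf (lose D∈ (here refl))

    ¬∈S : ∀ {ψ} → ¬ᶠ ψ ∈ S → ψ ∈ S
    ¬∈S {ψ} ¬ψ∈ = Sub-trans φ₀ ¬ψ∈ (there (Sub-refl ψ))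

    ∧∈Sˡ : ∀ {φ ψ} → φ ∧ᶠ ψ ∈ S → φ ∈ S
    ∧∈Sˡ {φ} ∧∈ = Sub-trans φ₀ ∧∈ (there (∈-++⁺ˡ (Sub-refl φ)))

    ∧∈Sʳ : ∀ {φ ψ} → φ ∧ᶠ ψ ∈ S → ψ ∈ S
    ∧∈Sʳ {φ} {ψ} ∧∈ = Sub-trans φ₀ ∧∈ (there (∈-++⁺ʳ (Sub φ) (Sub-refl ψ)))

    𝔻∈S : ∀ {X ψ} → 𝔻 X ψ ∈ S → ψ ∈ S
    𝔻∈S {ψ = ψ} 𝔻∈ = Sub-trans φ₀ 𝔻∈ (there (Sub-refl ψ))

  module Canonical (em : ExcludedMiddle 0ℓ) (φ₀ : Formula) where
    open Closure φ₀

    private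
      dne = em⇒dne em

    -- The language has no falsum constant; any contradiction will do.
    ⊥ᶠ : Formula
    ⊥ᶠ = φ₀ ∧ᶠ ¬ᶠ φ₀

    ⊥ᶠ-false : ∀ v → ¬ v ⊨ᵇ ⊥ᶠ
    ⊥ᶠ-false v t = let tφ₀ , t¬φ₀ = ∧ᵇ⁻ v φ₀ (¬ᶠ φ₀) t in ¬ᵇ⁻ v φ₀ t¬φ₀ tφ₀

    Consistent : List Formula → Set
    Consistent Γ = ¬ (Γ ⊩ ⊥ᶠ)

    ⊩-contradiction : ∀ {Γ ψ} → Consistent Γ → Γ ⊩ ψ → Γ ⊩ ¬ᶠ ψ → ⊥
    ⊩-contradiction {Γ} {ψ} cons d e = cons (⊩-taut Γ (ψ ∷ ¬ᶠ ψ ∷ []) ⊥ᶠ (d ∷ e ∷ [])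
      λ { v _ (tψ ∷ t¬ψ ∷ []) → ⊥-elim (¬ᵇ⁻ v ψ t¬ψ tψ) })

    ⊩-reductio : ∀ {Γ ψ} → (¬ᶠ ψ ∷ Γ) ⊩ ⊥ᶠ → Γ ⊩ ψ
    ⊩-reductio {Γ} {ψ} (⊩-intro d) = ⊩-intro (⊢-taut (_ ∷ []) (Γ ⇒* ψ) (d ∷ [])
      λ { v (t ∷ []) → ⇒*ᵇ⁺ v Γ ψ λ tΓ → decidable-stable (⊨ᵇ? v ψ) λ ¬tψ →
            ⊥ᶠ-false v (⇒*ᵇ⁻ v (¬ᶠ ψ ∷ Γ) ⊥ᶠ t (¬ᵇ⁺ v ψ ¬tψ ∷ tΓ)) })

    record MaximalConsistent (Γ : List Formula) : Set where
      field
        consistent : Consistent Γ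
        decides    : ∀ {ψ} → ψ ∈ Φ → Γ ⊩ ψ ⊎ Γ ⊩ ¬ᶠ ψ
    open MaximalConsistent

    ⊩-¬ : ∀ {Γ ψ} → MaximalConsistent Γ → ψ ∈ Φ → ¬ Γ ⊩ ψ → Γ ⊩ ¬ᶠ ψ
    ⊩-¬ Γ-mc ψ∈ ¬d with decides Γ-mc ψ∈
    ... | inj₁ d = ⊥-elim (¬d d)
    ... | inj₂ e = e

    extend : List Formula → List Formula → List Formula
    extend Γ []       = Γ
    extend Γ (ψ ∷ ψs) with em {(ψ ∷ Γ) ⊩ ⊥ᶠ}
    ... | yes _ = extend (¬ᶠ ψ ∷ Γ) ψs
    ... | no _  = extend (ψ ∷ Γ) ψs

    extend-⊇ : ∀ Γ ψs → Γ ⊆ extend Γ ψs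
    extend-⊇ Γ []       = id
    extend-⊇ Γ (ψ ∷ ψs) with em {(ψ ∷ Γ) ⊩ ⊥ᶠ}
    ... | yes _ = extend-⊇ (¬ᶠ ψ ∷ Γ) ψs ∘ there
    ... | no _  = extend-⊇ (ψ ∷ Γ) ψs ∘ there

    extend-consistent : ∀ Γ ψs → Consistent Γ → Consistent (extend Γ ψs)
    extend-consistent Γ []       cons = cons
    extend-consistent Γ (ψ ∷ ψs) cons with em {(ψ ∷ Γ) ⊩ ⊥ᶠ}
    ... | yes inc = extend-consistent (¬ᶠ ψ ∷ Γ) ψs (cons ∘ ⊩-cases Γ ψ ⊥ᶠ inc)
    ... | no cons′ = extend-consistent (ψ ∷ Γ) ψs cons′

    extend-decides : ∀ Γ ψs {ψ} → ψ ∈ ψs → ψ ∈ extend Γ ψs ⊎ ¬ᶠ ψ ∈ extend Γ ψs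
    extend-decides Γ (χ ∷ ψs) ψ∈ with em {(χ ∷ Γ) ⊩ ⊥ᶠ} | ψ∈
    ... | yes _ | here refl = inj₂ (extend-⊇ (¬ᶠ χ ∷ Γ) ψs (here refl))
    ... | no _  | here refl = inj₁ (extend-⊇ (χ ∷ Γ) ψs (here refl))
    ... | yes _ | there ψ∈′ = extend-decides (¬ᶠ χ ∷ Γ) ψs ψ∈′
    ... | no _  | there ψ∈′ = extend-decides (χ ∷ Γ) ψs ψ∈′

    lindenbaum : ∀ {Γ} → Consistent Γ → Σ (List Formula) λ Δ → MaximalConsistent Δ × Γ ⊆ Δ
    lindenbaum {Γ} cons = extend Γ Φ , Δ-mc , extend-⊇ Γ Φ
      where
      Δ-mc : MaximalConsistent (extend Γ Φ)
      Δ-mc .consistent = extend-consistent Γ Φ cons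
      Δ-mc .decides ψ∈ = Sum.map ⊩-∈ ⊩-∈ (extend-decides Γ Φ ψ∈)

    Agree : List V → List Formula → List Formula → Set
    Agree X Γ Δ = ∀ {χ} → χ ∈ Φ → Γ ⊩D[ X ] Free χ → Γ ⊩ χ ⇔ Δ ⊩ χ

    Agree-refl : ∀ {X Γ} → Agree X Γ Γ
    Agree-refl _ _ = ⇔-id _

    Agree-D : ∀ {X Γ Δ y} → X ∈ VarSets → Agree X Γ Δ → y ∈ Vars → Γ ⊩ D X y ⇔ Δ ⊩ D X y
    Agree-D X∈ agr y∈ = agr (D∈Φ X∈ y∈) (⊩D-⊆ id)

    Agree-sym : ∀ {X Γ Δ} → X ∈ VarSets → Agree X Γ Δ → Agree X Δ Γ
    Agree-sym X∈ agr χ∈ ds = ⇔-sym (agr χ∈ λ z∈ → from (Agree-D X∈ agr (Free⊆Vars χ∈ z∈)) (ds z∈))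

    Agree-trans : ∀ {X Γ Δ Θ} → X ∈ VarSets → Agree X Γ Δ → Agree X Δ Θ → Agree X Γ Θ
    Agree-trans X∈ agr agr′ χ∈ ds =
      agr′ χ∈ (λ z∈ → to (Agree-D X∈ agr (Free⊆Vars χ∈ z∈)) (ds z∈)) ⇔-∘ agr χ∈ ds

    Agree-mono : ∀ {X Y Γ Δ} → Agree Y Γ Δ → Γ ⊩D[ Y ] X → Agree X Γ Δ
    Agree-mono agr YX χ∈ ds = agr χ∈ (⊩D-trans YX ds)

    module Witness {Γ : List Formula} (Γ-mc : MaximalConsistent Γ) (X : List V) where

      signed : Formula → Formula
      signed χ with em {Γ ⊩ χ}
      ... | yes _ = χ
      ... | no _  = ¬ᶠ χ

      signed-pos : ∀ {χ} → Γ ⊩ χ → signed χ ≡ χ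
      signed-pos {χ} d with em {Γ ⊩ χ}
      ... | yes _ = refl
      ... | no ¬d = ⊥-elim (¬d d)

      signed-neg : ∀ {χ} → ¬ Γ ⊩ χ → signed χ ≡ ¬ᶠ χ
      signed-neg {χ} ¬d with em {Γ ⊩ χ}
      ... | yes d = ⊥-elim (¬d d)
      ... | no _  = refl

      ⊩-signed : ∀ {χ} → χ ∈ Φ → Γ ⊩ signed χ
      ⊩-signed {χ} χ∈ with em {Γ ⊩ χ}
      ... | yes d = d
      ... | no ¬d = ⊩-¬ Γ-mc χ∈ ¬d

      Free-signed : ∀ χ → Free (signed χ) ≡ Free χ
      Free-signed χ with em {Γ ⊩ χ}
      ... | yes _ = refl
      ... | no _  = refl

      determined? : ∀ χ → Dec (Γ ⊩D[ X ] Free χ)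
      determined? χ = em

      X-theory : List Formula
      X-theory = map signed (filter determined? Φ)

      signed∈X-theory : ∀ {χ} → χ ∈ Φ → Γ ⊩D[ X ] Free χ → signed χ ∈ X-theory
      signed∈X-theory χ∈ ds = ∈-map⁺ signed (∈-filter⁺ determined? χ∈ (λ {_} → ds))

      ⊩-𝔻-X-theory : ∀ {δ} → δ ∈ map (𝔻 X) X-theory → Γ ⊩ δ
      ⊩-𝔻-X-theory δ∈
        with κ , κ∈ , refl ← ∈-map⁻ (𝔻 X) δ∈
        with χ , χ∈ , refl ← ∈-map⁻ signed κ∈
        with χ∈Φ , ds ← ∈-filter⁻ determined? χ∈ =
        ⊩-𝔻-determined (subst (Γ ⊩D[ X ]_) (sym (Free-signed χ)) ds) (⊩-signed χ∈Φ)

      Agree-X-theory : ∀ {Δ} → Consistent Δ → X-theory ⊆ Δ → Agree X Γ Δ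
      Agree-X-theory {Δ} cons ⊆Δ {χ} χ∈ ds = mk⇔
        (λ d → ⊩-∈ (⊆Δ (subst (_∈ X-theory) (signed-pos d) (signed∈X-theory χ∈ ds))))
        (λ e → dne λ ¬d → ⊩-contradiction cons e
          (⊩-∈ (⊆Δ (subst (_∈ X-theory) (signed-neg ¬d) (signed∈X-theory χ∈ ds)))))

      𝔻-witness : ∀ {ψ} → Γ ⊩ ¬ᶠ 𝔻 X ψ → Σ (List Formula) λ Δ → MaximalConsistent Δ × Agree X Γ Δ × Δ ⊩ ¬ᶠ ψ
      𝔻-witness {ψ} ⊩¬𝔻ψ =
        let Δ , Δ-mc , ⊆Δ = lindenbaum {¬ᶠ ψ ∷ X-theory} ¬ψ-consistent
        in Δ , Δ-mc , Agree-X-theory (consistent Δ-mc) (⊆Δ ∘ there) , ⊩-∈ (⊆Δ (here refl))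
        where
        ¬ψ-consistent : Consistent (¬ᶠ ψ ∷ X-theory)
        ¬ψ-consistent inc = ⊩-contradiction (consistent Γ-mc)
          (⊩-cut (map (𝔻 X) X-theory) ⊩-𝔻-X-theory (RK X X-theory ψ (deduction (⊩-reductio inc))))
          ⊩¬𝔻ψ

    module Unravelling {Γ₀ : List Formula} (Γ₀-mc : MaximalConsistent Γ₀) where

      data Path : Set where
        root : Path
        step : Path → List V → List Formula → Path

      last : Path → List Formula
      last root         = Γ₀
      last (step π X Δ) = Δ

      Coherent : Path → Set
      Coherent root         = ⊤
      Coherent (step π X Δ) = Coherent π × X ∈ VarSets × MaximalConsistent Δ × Agree X (last π) Δ

      last-mc : ∀ {π} → Coherent π → MaximalConsistent (last π)
      last-mc {root}       _                  = Γ₀-mc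
      last-mc {step π X Δ} (_ , _ , Δ-mc , _) = Δ-mc

      length : Path → ℕ
      length root         = zero
      length (step π X Δ) = suc (length π)

      lastChange : V → Path → Path
      lastChange x root = root
      lastChange x (step π X Δ) with em {last π ⊩ D X x}
      ... | yes _ = lastChange x π
      ... | no _  = step π X Δ

      lastChange-kept : ∀ {x π X Δ} → last π ⊩ D X x → lastChange x (step π X Δ) ≡ lastChange x π
      lastChange-kept {x} {π} {X} d with em {last π ⊩ D X x}
      ... | yes _ = refl
      ... | no ¬d = ⊥-elim (¬d d)

      lastChange-changed : ∀ {x π X Δ} → ¬ last π ⊩ D X x → lastChange x (step π X Δ) ≡ step π X Δ
      lastChange-changed {x} {π} {X} ¬d with em {last π ⊩ D X x}
      ... | yes d = ⊥-elim (¬d d)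
      ... | no _  = refl

      infix 4 _≼_
      data _≼_ : Path → Path → Set where
        ≼-refl : ∀ {π} → π ≼ π
        ≼-step : ∀ {π ρ X Δ} → π ≼ ρ → π ≼ step ρ X Δ

      ≼-length : ∀ {π ρ} → π ≼ ρ → length π ≤ length ρ
      ≼-length ≼-refl     = ≤-refl
      ≼-length (≼-step p) = m≤n⇒m≤1+n (≼-length p)

      ≼-≥-length⇒≡ : ∀ {π ρ} → π ≼ ρ → length ρ ≤ length π → π ≡ ρ
      ≼-≥-length⇒≡ ≼-refl     _ = refl
      ≼-≥-length⇒≡ (≼-step p) le = ⊥-elim (1+n≰n (≤-trans (s≤s (≼-length p)) le))

      lastChange-≼ : ∀ x π → lastChange x π ≼ π
      lastChange-≼ x root = ≼-refl
      lastChange-≼ x (step π X Δ) with em {last π ⊩ D X x}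
      ... | yes _ = ≼-step (lastChange-≼ x π)
      ... | no _  = ≼-refl

      SameChanges : List V → Path → Path → Set
      SameChanges X π ρ = ∀ {x} → x ∈ X → lastChange x π ≡ lastChange x ρ

      Synchronised : List V → Path → Path → Set
      Synchronised X π ρ =
        Agree X (last π) (last ρ) × (∀ {y} → y ∈ Vars → last π ⊩ D X y → lastChange y π ≡ lastChange y ρ)

      module _ {X : List V} (X∈ : X ∈ VarSets) where

        Synchronised-refl : ∀ π → Synchronised X π π
        Synchronised-refl π = Agree-refl , λ _ _ → refl

        Synchronised-sym : ∀ {π ρ} → Synchronised X ρ π → Synchronised X π ρ
        Synchronised-sym (agr , same) =
          Agree-sym X∈ agr , λ y∈ d → sym (same y∈ (from (Agree-D X∈ agr y∈) d))

        synchronised : ∀ π ρ → Coherent π → Coherent ρ → SameChanges X π ρ → Synchronised X π ρ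
        synchronised-≥ : ∀ π ρ → length ρ ≤ length π → Coherent π → Coherent ρ → SameChanges X π ρ →
                         Synchronised X π ρ

        synchronised π ρ cπ cρ same with length ρ ≤? length π
        ... | yes le = synchronised-≥ π ρ le cπ cρ same
        ... | no ≰  = Synchronised-sym {π} {ρ} (synchronised-≥ ρ π (≰⇒≥ ≰) cρ cπ (sym ∘ same))

        -- If the last step of π keeps every x ∈ X, drop it; otherwise that step is lastChange x of
        -- both paths for some x ∈ X, so ρ extends π and, being no longer, is π.
        synchronised-≥ root         root _ _  _  _ = Synchronised-refl root
        synchronised-≥ (step π Y Δ) ρ le (cπ , _ , _ , agr) cρ same
          with All.all? (λ x → em {last π ⊩ D Y x}) X
        ... | yes allKept =
          Agree-trans X∈ (Agree-sym X∈ agrX) (proj₁ IH) ,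
          λ y∈ d → let d′ = from (Agree-D X∈ agrX y∈) d in
            trans (lastChange-kept (⊩-D-trans kept d′)) (proj₂ IH y∈ d′)
          where
          kept : last π ⊩D[ Y ] X
          kept = All.lookup allKept
          IH = synchronised π ρ cπ cρ λ x∈ → trans (sym (lastChange-kept (kept x∈))) (same x∈)
          agrX : Agree X (last π) Δ
          agrX = Agree-mono agr kept
        ... | no ¬allKept with x , x∈ , changed ← find (All.¬All⇒Any¬ (λ x → em) X ¬allKept) =
          subst (Synchronised X (step π Y Δ)) π≡ρ (Synchronised-refl _)
          where
          π≡ρ : step π Y Δ ≡ ρ
          π≡ρ = ≼-≥-length⇒≡ (subst (_≼ ρ) (trans (sym (same x∈)) (lastChange-changed changed))
                                       (lastChange-≼ x ρ)) le

      assignment : Path → V → V × Path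
      assignment π x = x , lastChange x π

      unravelled : Model
      unravelled = record
        { O = V × Path
        ; I = λ P os → Σ Path λ π → Σ (Vec V (ar P)) λ xs →
                Coherent π × vmap (assignment π) xs ≡ os × last π ⊩ atom P xs
        ; A = λ t → Σ Path λ π → Coherent π × (∀ x → t x ≡ assignment π x)
        }

      assignment-admissible : ∀ {π} → Coherent π → Model.A unravelled (assignment π)
      assignment-admissible {π} cπ = π , cπ , λ _ → refl

      =[]⇒SameChanges : ∀ {X t} π ρ → (∀ x → t x ≡ assignment ρ x) → assignment π =[ X ] t → SameChanges X π ρ
      =[]⇒SameChanges π ρ t≡ eq {x} x∈ = cong proj₂ (trans (eq x x∈) (t≡ x))

      assignment-step : ∀ π X Δ → assignment π =[ X ] assignment (step π X Δ)
      assignment-step π X Δ x x∈ = cong (x ,_) (sym (lastChange-kept (⊢⇒⊩ (projection _ x x∈))))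

      map-assignment-injective : ∀ {n} π ρ (xs ys : Vec V n) → vmap (assignment π) xs ≡ vmap (assignment ρ) ys →
                                 xs ≡ ys × SameChanges (toList xs) π ρ
      map-assignment-injective π ρ []ᵛ       []ᵛ       _  = refl , λ ()
      map-assignment-injective π ρ (x ∷ᵛ xs) (y ∷ᵛ ys) eq with refl ← cong proj₁ (∷-injectiveˡ eq)
        with xs≡ys , same ← map-assignment-injective π ρ xs ys (∷-injectiveʳ eq) =
        cong (x ∷ᵛ_) xs≡ys , λ { (here refl) → cong proj₂ (∷-injectiveˡ eq) ; (there x∈) → same x∈ }

      TruthLemma : Formula → Set
      TruthLemma ψ = ∀ π → Coherent π → unravelled , assignment π ⊨ ψ ⇔ last π ⊩ ψ

      truth-atom : ∀ {P xs} → atom P xs ∈ S → TruthLemma (atom P xs)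
      truth-atom {P} {xs} atom∈ π cπ = mk⇔ forward (λ d → π , xs , cπ , refl , d)
        where
        forward : unravelled , assignment π ⊨ atom P xs → last π ⊩ atom P xs
        forward (ρ , ys , cρ , eq , d) with refl , same ← map-assignment-injective ρ π ys xs eq =
          to (proj₁ (synchronised (varSetsOf⊆VarSets atom∈ (here refl)) ρ π cρ cπ same) (S⊆Φ atom∈) (⊩D-⊆ id)) d

      truth-D : ∀ {X y} → D X y ∈ S → TruthLemma (D X y)
      truth-D {X} {y} D∈ π cπ = mk⇔ forward backward
        where
        X∈ = varSetsOf⊆VarSets D∈ (here refl)
        backward : last π ⊩ D X y → unravelled , assignment π ⊨ D X y
        backward d t (ρ , cρ , t≡) eq =
          trans (cong (y ,_) (proj₂ (synchronised X∈ π ρ cπ cρ (=[]⇒SameChanges π ρ t≡ eq)) (D∈S⇒∈Vars D∈) d))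
                (sym (t≡ y))
        forward : unravelled , assignment π ⊨ D X y → last π ⊩ D X y
        -- Were D_X y unprovable, the step from last π to itself along X would change y but no x ∈ X.
        forward sem = dne λ ¬d →
          let ρ = step π X (last π)
              lastChange≡ρ : lastChange y π ≡ ρ
              lastChange≡ρ = trans (cong proj₂ (sem (assignment ρ)
                                     (assignment-admissible (cπ , X∈ , last-mc cπ , Agree-refl))
                                     (assignment-step π X (last π))))
                                   (lastChange-changed ¬d)
          in 1+n≰n (≼-length (subst (_≼ π) lastChange≡ρ (lastChange-≼ y π)))

      truth-𝔻 : ∀ {X ψ} → 𝔻 X ψ ∈ S → TruthLemma ψ → TruthLemma (𝔻 X ψ)
      truth-𝔻 {X} {ψ} 𝔻∈ IH π cπ = mk⇔ forward backward
        where
        X∈ = varSetsOf⊆VarSets 𝔻∈ (here refl)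
        backward : last π ⊩ 𝔻 X ψ → unravelled , assignment π ⊨ 𝔻 X ψ
        backward d t At@(ρ , cρ , t≡) eq =
          ⊨-coincidence unravelled ψ (assignment-admissible cρ) At (λ x _ → sym (t≡ x)) (from (IH ρ cρ) dψ)
          where
          dρ = to (proj₁ (synchronised X∈ π ρ cπ cρ (=[]⇒SameChanges π ρ t≡ eq)) (S⊆Φ 𝔻∈) (⊩D-⊆ id)) d
          dψ = ⊩-mp (⊢⇒⊩ (𝔻-elim X ψ)) dρ
        forward : unravelled , assignment π ⊨ 𝔻 X ψ → last π ⊩ 𝔻 X ψ
        forward sem = dne λ ¬d →
          let Δ , Δ-mc , agr , ⊩¬ψ = Witness.𝔻-witness (last-mc cπ) X (⊩-¬ (last-mc cπ) (S⊆Φ 𝔻∈) ¬d)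
              cρ = cπ , X∈ , Δ-mc , λ {_} → agr
          in ⊩-contradiction (consistent Δ-mc)
               (to (IH (step π X Δ) cρ) (sem _ (assignment-admissible cρ) (assignment-step π X Δ))) ⊩¬ψ

      truth : ∀ ψ → ψ ∈ S → TruthLemma ψ
      truth (atom P xs) ψ∈ = truth-atom ψ∈
      truth (¬ᶠ ψ) ψ∈ π cπ = mk⇔
        (λ ¬sem → ⊩-¬ (last-mc cπ) (S⊆Φ (¬∈S ψ∈)) (¬sem ∘ from IH))
        (λ d sem → ⊩-contradiction (consistent (last-mc cπ)) (to IH sem) d)
        where IH = truth ψ (¬∈S ψ∈) π cπ
      truth (φ ∧ᶠ ψ) ψ∈ π cπ = mk⇔
        (λ (p , q) → ⊩-∧⁺ (to IHφ p) (to IHψ q))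
        (λ d → from IHφ (⊩-∧⁻ˡ d) , from IHψ (⊩-∧⁻ʳ d))
        where IHφ = truth φ (∧∈Sˡ ψ∈) π cπ
              IHψ = truth ψ (∧∈Sʳ ψ∈) π cπ
      truth (𝔻 X ψ) ψ∈ = truth-𝔻 ψ∈ (truth ψ (𝔻∈S ψ∈))
      truth (D X y) ψ∈ = truth-D ψ∈

    completeness : Valid φ₀ → ⊢ φ₀
    completeness valid = dne λ ¬⊢φ₀ →
      let Γ₀ , Γ₀-mc , ⊆Γ₀ = lindenbaum {¬ᶠ φ₀ ∷ []} (¬⊢φ₀ ∘ deduction ∘ ⊩-reductio)
          open Unravelling Γ₀-mc
          sem = valid unravelled (assignment root) (assignment-admissible tt)
      in ⊩-contradiction (consistent Γ₀-mc) (to (truth φ₀ (Sub-refl φ₀) root tt) sem) (⊩-∈ (⊆Γ₀ (here refl)))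

theorem5p3 : (V Pred : Set) (ar : Pred → ℕ) → ExcludedMiddle 0ℓ →
    (φ : LFD.Formula V Pred ar) →
    (LFD.⊢_ V Pred ar φ → LFD.Valid V Pred ar φ) × (LFD.Valid V Pred ar φ → LFD.⊢_ V Pred ar φ)
theorem5p3 V Pred ar em φ = Soundness.soundness V Pred ar em , Canonical.completeness V Pred ar em φ
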